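{- Let $G$ be a finite simple connected graph with $n(G)\ge 4$. (i) If $G$ has a dominating vertex, then $o(K_m\circ G)=\mathcal{S}$ for every $m\ge 4$. (ii) If $G$ has two dominating vertices, then $o(K_m\circ G)=\mathcal{S}$ for $m\in\{2,3\}$. Moreover, in each of these cases Spoiler can win the game in two moves.
   Context: A dominating vertex of $G$ is a vertex adjacent to all other vertices. $K_m$ is the complete graph on $m$ vertices. The lexicographic product $G_1\circ G_2$ has vertex set $V(G_1)\times V(G_2)$, with $(g,h)(g',h')$ an edge iff $gg'\in E(G_1)$, or $g=g'$ and $hh'\in E(G_2)$. A set $W\subseteq V(X)$ is a resolving set of a connected graph $X$ if for every two distinct vertices $x,y$ there is $z\in W$ with $d(x,z)\ne d(y,z)$. In the Maker-Breaker resolving game on $X$, Resolver and Spoiler alternately select unplayed vertices of $X$; Resolver wins if the vertices he selects contain a resolving set of $X$, and Spoiler wins if she selects at least one vertex of every resolving set of $X$. The outcome $o(X)=\mathcal{S}$ means Spoiler has a winning strategy no matter who starts the game. -}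

module Defs where

open import Data.Nat using (ℕ; zero; suc; _<_)
open import Data.Fin using (Fin)
open import Data.Product using (Σ; ∃; ∃-syntax; _×_; _,_)
open import Data.Sum using (_⊎_; inj₁; inj₂)
open import Data.Empty using (⊥)
open import Data.List using (List; []; _∷_)
open import Data.List.Membership.Propositional using (_∈_; _∉_)
open import Relation.Nullary using (¬_)
open import Relation.Binary.PropositionalEquality using (_≡_; _≢_; refl; sym)

record Graph (V : Set) : Set₁ where
  field
    E        : V → V → Set
    E-sym    : ∀ {x y} → E x y → E y x
    E-irrefl : ∀ {x} → ¬ E x x
open Graph public

K : (m : ℕ) → Graph (Fin m)
K m = record { E = λ i j → i ≢ j ; E-sym = λ p q → p (sym q) ; E-irrefl = λ p → p refl }

lexE : ∀ {A B : Set} → Graph A → Graph B → A × B → A × B → Set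
lexE G₁ G₂ (g , h) (g' , h') = E G₁ g g' ⊎ (g ≡ g' × E G₂ h h')

lex-sym : ∀ {A B : Set} (G₁ : Graph A) (G₂ : Graph B) {x y : A × B} →
          lexE G₁ G₂ x y → lexE G₁ G₂ y x
lex-sym G₁ G₂ (inj₁ e) = inj₁ (E-sym G₁ e)
lex-sym G₁ G₂ (inj₂ (refl , e)) = inj₂ (refl , E-sym G₂ e)

lex-irrefl : ∀ {A B : Set} (G₁ : Graph A) (G₂ : Graph B) {x : A × B} → ¬ lexE G₁ G₂ x x
lex-irrefl G₁ G₂ (inj₁ e) = E-irrefl G₁ e
lex-irrefl G₁ G₂ (inj₂ (_ , e)) = E-irrefl G₂ e

_∘L_ : ∀ {A B : Set} → Graph A → Graph B → Graph (A × B)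
G₁ ∘L G₂ = record { E = lexE G₁ G₂ ; E-sym = lex-sym G₁ G₂ ; E-irrefl = lex-irrefl G₁ G₂ }

module _ {V : Set} (G : Graph V) where

  data Walk : V → V → ℕ → Set where
    nil  : ∀ {x} → Walk x x zero
    cons : ∀ {x y z k} → E G x y → Walk y z k → Walk x z (suc k)

  Connected : Set
  Connected = ∀ x y → ∃[ k ] Walk x y k

  IsDist : V → V → ℕ → Set
  IsDist x y k = Walk x y k × (∀ j → j < k → ¬ Walk x y j)

  Dominating : V → Set
  Dominating x = ∀ y → y ≢ x → E G x y

  HasDominating : Set
  HasDominating = ∃[ x ] Dominating x

  HasTwoDominating : Set
  HasTwoDominating = ∃[ x ] ∃[ y ] (x ≢ y × Dominating x × Dominating y)

  Distinguishes : V → V → V → Set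
  Distinguishes z x y = ∃[ a ] ∃[ b ] (IsDist x z a × IsDist y z b × a ≢ b)

  Resolving : List V → Set
  Resolving W = ∀ x y → x ≢ y → ∃[ z ] (z ∈ W × Distinguishes z x y)

  -- Spoiler's claimed set S meets every resolving set.
  Blocks : List V → Set
  Blocks S = ∀ (W : List V) → Resolving W → ∃[ v ] (v ∈ W × v ∈ S)

  Free : List V → List V → V → Set
  Free R S v = v ∉ R × v ∉ S

  -- Game positions (R = Resolver's vertices, S = Spoiler's vertices).
  -- SpoilerToMove k R S : Spoiler to move, she can force a win making at most k more moves.
  -- ResolverToMove k R S : Resolver to move, Spoiler can force a win making at most k more moves.
  SpoilerToMove  : ℕ → List V → List V → Set
  ResolverToMove : ℕ → List V → List V → Set

  SpoilerToMove zero    R S = Blocks S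
  SpoilerToMove (suc k) R S =
    Blocks S ⊎ (∃[ v ] (Free R S v × ResolverToMove k R (v ∷ S)))

  ResolverToMove k R S =
    Blocks S ⊎ ((∃[ v ] Free R S v) × (∀ v → Free R S v → SpoilerToMove k (v ∷ R) S))

  -- o(X) = S : Spoiler has a winning strategy whoever starts.
  OutcomeSpoiler : Set
  OutcomeSpoiler = (∃[ k ] SpoilerToMove k [] []) × (∃[ k ] ResolverToMove k [] [])

  SpoilerWinsInTwoMoves : Set
  SpoilerWinsInTwoMoves = SpoilerToMove 2 [] [] × ResolverToMove 2 [] []

{-# OPTIONS --safe #-}
-- Two distinct dominating vertices of a graph are at distance 1 from every
-- other vertex, so no third vertex distinguishes them and every resolving set
-- contains one of them. If the graph has four distinct dominating vertices,
-- Spoiler can always claim two of them with her first two moves, whoever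
-- starts. In K_m ∘ G the vertex (i , u) is dominating whenever u dominates G,
-- so there are m ≥ 4 such vertices when G has one dominating vertex, and
-- 2m ≥ 4 when G has two.
module Submission where

open import Defs
open import Data.Nat using (ℕ; _≤_; _<_; _*_; z≤n; s≤s)
open import Data.Nat.Properties using (≤-trans; ≤-refl; m≤n⇒m≤1+n; m≤m+n; *-identityʳ)
open import Data.Fin using (Fin; zero; suc; remQuot; combine)
import Data.Fin as Fin
open import Data.Fin.Properties using (pigeonhole; ¬∀⟶∃¬; <⇒≢; combine-remQuot)
open import Data.Product using (_×_; _,_; proj₁; proj₂; ∃-syntax; uncurry)
open import Data.Product.Properties using (≡-dec; ×-≡,≡→≡)
open import Data.Sum using (_⊎_; inj₁; inj₂)
open import Data.Empty using (⊥-elim)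
open import Data.List using (List; []; _∷_; _++_; length; lookup)
open import Data.List.Relation.Unary.Any using (here; there; index)
open import Data.List.Relation.Unary.Any.Properties using (lookup-index)
open import Data.List.Membership.Propositional using (_∈_; _∉_)
open import Data.List.Membership.Propositional.Properties using (∈-++⁺ˡ; ∈-++⁺ʳ)
import Data.List.Membership.DecPropositional as DecMembership
open import Function using (id; _∘_)
open import Function.Definitions using (Injective)
open import Relation.Nullary using (¬_; yes; no)
open import Relation.Binary.Definitions using (DecidableEquality)
open import Relation.Binary.PropositionalEquality
  using (_≡_; _≢_; refl; sym; trans; cong; subst; module ≡-Reasoning)

injective⇒∃∉ : ∀ {V : Set} → DecidableEquality V → ∀ {k} (f : Fin k → V) →
               Injective _≡_ _≡_ f → (xs : List V) → length xs < k → ∃[ i ] f i ∉ xs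
injective⇒∃∉ _≟_ {k} f f-injective xs |xs|<k =
  ¬∀⟶∃¬ k (λ i → f i ∈ xs) (λ i → f i ∈? xs) not-all-in
  where
  open DecMembership _≟_ using (_∈?_)

  not-all-in : ¬ (∀ i → f i ∈ xs)
  not-all-in f∈xs with pigeonhole |xs|<k (index ∘ f∈xs)
  ... | i , j , i<j , same-index = <⇒≢ i<j (f-injective (begin
    f i                        ≡⟨ lookup-index (f∈xs i) ⟩
    lookup xs (index (f∈xs i)) ≡⟨ cong (lookup xs) same-index ⟩
    lookup xs (index (f∈xs j)) ≡⟨ sym (lookup-index (f∈xs j)) ⟩
    f j                        ∎))
    where open ≡-Reasoning

remQuot-injective : ∀ {n} k {i j : Fin (n * k)} → remQuot {n} k i ≡ remQuot k j → i ≡ j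
remQuot-injective {n} k {i} {j} eq = begin
  i                                 ≡⟨ sym (combine-remQuot {n} k i) ⟩
  uncurry combine (remQuot {n} k i) ≡⟨ cong (uncurry combine) eq ⟩
  uncurry combine (remQuot {n} k j) ≡⟨ combine-remQuot {n} k j ⟩
  j                                 ∎
  where open ≡-Reasoning

module _ {V : Set} (X : Graph V) where

  adjacent⇒dist≡1 : ∀ {x z a} → E X x z → IsDist X x z a → a ≡ 1
  adjacent⇒dist≡1 e (nil , _)                = ⊥-elim (E-irrefl X e)
  adjacent⇒dist≡1 e (cons _ nil , _)         = refl
  adjacent⇒dist≡1 e (cons _ (cons _ _) , min) = ⊥-elim (min 1 (s≤s (s≤s z≤n)) (cons e nil))

  dominating-undistinguished : ∀ {d₁ d₂ z} → Dominating X d₁ → Dominating X d₂ →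
                               z ≢ d₁ → z ≢ d₂ → ¬ Distinguishes X z d₁ d₂
  dominating-undistinguished D₁ D₂ z≢d₁ z≢d₂ (a , b , dist₁ , dist₂ , a≢b) =
    a≢b (trans (adjacent⇒dist≡1 (D₁ _ z≢d₁) dist₁) (sym (adjacent⇒dist≡1 (D₂ _ z≢d₂) dist₂)))

  dominating-pair-blocks : DecidableEquality V → ∀ {d₁ d₂ S} → d₁ ≢ d₂ →
                           Dominating X d₁ → Dominating X d₂ → d₁ ∈ S → d₂ ∈ S → Blocks X S
  dominating-pair-blocks _≟_ {d₁} {d₂} d₁≢d₂ D₁ D₂ d₁∈S d₂∈S W resolving
    with resolving d₁ d₂ d₁≢d₂
  ... | z , z∈W , z-distinguishes with z ≟ d₁ | z ≟ d₂
  ...   | yes refl | _        = z , z∈W , d₁∈S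
  ...   | no _     | yes refl = z , z∈W , d₂∈S
  ...   | no z≢d₁  | no z≢d₂  =
    ⊥-elim (dominating-undistinguished D₁ D₂ z≢d₁ z≢d₂ z-distinguishes)

  record DominatingFamily (k : ℕ) : Set where
    field
      vertex     : Fin k → V
      injective  : Injective _≡_ _≡_ vertex
      dominating : ∀ i → Dominating X (vertex i)

  open DominatingFamily

  module SpoilerStrategy (_≟_ : DecidableEquality V) {k} (D : DominatingFamily k) (4≤k : 4 ≤ k) where

    fresh-dominating : (xs : List V) → length xs ≤ 3 → ∃[ d ] (Dominating X d × d ∉ xs)
    fresh-dominating xs |xs|≤3 with injective⇒∃∉ _≟_ (vertex D) (injective D) xs (≤-trans (s≤s |xs|≤3) 4≤k)
    ... | i , i∉xs = vertex D i , dominating D i , i∉xs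

    free : ∀ {R S v} → v ∉ R ++ S → Free X R S v
    free {R} v∉R++S = v∉R++S ∘ ∈-++⁺ˡ , v∉R++S ∘ ∈-++⁺ʳ R

    free-vertex : ∀ R S → length (R ++ S) ≤ 3 → ∃[ v ] Free X R S v
    free-vertex R S |R++S|≤3 with fresh-dominating (R ++ S) |R++S|≤3
    ... | v , _ , v∉R++S = v , free v∉R++S

    spoiler-claims-second : ∀ {d₁ R S} → Dominating X d₁ → d₁ ∈ S → length (R ++ S) ≤ 3 →
                            SpoilerToMove X 1 R S
    spoiler-claims-second {d₁} {R} {S} D₁ d₁∈S |R++S|≤3 with fresh-dominating (R ++ S) |R++S|≤3
    ... | d₂ , D₂ , d₂∉R++S =
      inj₂ (d₂ , free d₂∉R++S , inj₁ (dominating-pair-blocks _≟_ d₁≢d₂ D₁ D₂ (there d₁∈S) (here refl)))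
      where
      d₁≢d₂ : d₁ ≢ d₂
      d₁≢d₂ refl = d₂∉R++S (∈-++⁺ʳ R d₁∈S)

    resolver-after-first-claim : ∀ {d₁ R S} → Dominating X d₁ → d₁ ∈ S → length (R ++ S) ≤ 2 →
                                 ResolverToMove X 1 R S
    resolver-after-first-claim {R = R} {S} D₁ d₁∈S |R++S|≤2 =
      inj₂ (free-vertex R S (m≤n⇒m≤1+n |R++S|≤2) ,
            λ _ _ → spoiler-claims-second D₁ d₁∈S (s≤s |R++S|≤2))

    spoiler-first : SpoilerToMove X 2 [] []
    spoiler-first with fresh-dominating [] z≤n
    ... | d₁ , D₁ , _ = inj₂ (d₁ , free (λ ()) , resolver-after-first-claim D₁ (here refl) (s≤s z≤n))

    resolver-first : ResolverToMove X 2 [] []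
    resolver-first = inj₂ (free-vertex [] [] z≤n , spoiler-answers)
      where
      spoiler-answers : ∀ r → Free X [] [] r → SpoilerToMove X 2 (r ∷ []) []
      spoiler-answers r _ with fresh-dominating (r ∷ []) (s≤s z≤n)
      ... | d₁ , D₁ , d₁∉[r] =
        inj₂ (d₁ , free d₁∉[r] , resolver-after-first-claim D₁ (here refl) (s≤s (s≤s z≤n)))

    spoiler-wins : OutcomeSpoiler X × SpoilerWinsInTwoMoves X
    spoiler-wins = ((2 , spoiler-first) , (2 , resolver-first)) , spoiler-first , resolver-first

open DominatingFamily

module _ {V : Set} {G : Graph V} where

  dominatingFamily₁ : HasDominating G → DominatingFamily G 1
  dominatingFamily₁ (u , Du) = record
    { vertex = λ _ → u ; injective = λ { {zero} {zero} _ → refl } ; dominating = λ _ → Du }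

  dominatingFamily₂ : HasTwoDominating G → DominatingFamily G 2
  dominatingFamily₂ (u , v , u≢v , Du , Dv) = record
    { vertex = vertex′ ; injective = injective′ ; dominating = dominating′ }
    where
    vertex′ : Fin 2 → V
    vertex′ zero       = u
    vertex′ (suc zero) = v

    injective′ : Injective _≡_ _≡_ vertex′
    injective′ {zero}     {zero}     _   = refl
    injective′ {zero}     {suc zero} u≡v = ⊥-elim (u≢v u≡v)
    injective′ {suc zero} {zero}     v≡u = ⊥-elim (u≢v (sym v≡u))
    injective′ {suc zero} {suc zero} _   = refl

    dominating′ : ∀ i → Dominating G (vertex′ i)
    dominating′ zero       = Du
    dominating′ (suc zero) = Dv

K-dominatingFamily : ∀ m → DominatingFamily (K m) m
K-dominatingFamily m = record { vertex = id ; injective = id ; dominating = λ i j j≢i → j≢i ∘ sym }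

module _ {A B : Set} (G₁ : Graph A) (G₂ : Graph B) (_≟_ : DecidableEquality A) where

  lex-dominating : ∀ {g h} → Dominating G₁ g → Dominating G₂ h → Dominating (G₁ ∘L G₂) (g , h)
  lex-dominating {g} Dg Dh (g′ , h′) ≢gh with g′ ≟ g
  ... | no g′≢g  = inj₁ (Dg g′ g′≢g)
  ... | yes refl = inj₂ (refl , Dh h′ (≢gh ∘ cong (g ,_)))

  lex-dominatingFamily : ∀ {p q} → DominatingFamily G₁ p → DominatingFamily G₂ q →
                         DominatingFamily (G₁ ∘L G₂) (p * q)
  lex-dominatingFamily {p} {q} D₁ D₂ = record
    { vertex     = vertex′
    ; injective  = λ eq → remQuot-injective {p} q
        (×-≡,≡→≡ (injective D₁ (cong proj₁ eq) , injective D₂ (cong proj₂ eq)))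
    ; dominating = λ i → lex-dominating (dominating D₁ _) (dominating D₂ _)
    }
    where
    vertex′ : Fin (p * q) → A × B
    vertex′ i = vertex D₁ (proj₁ (remQuot {p} q i)) , vertex D₂ (proj₂ (remQuot {p} q i))

proposition4p3 : (n : ℕ) (G : Graph (Fin n)) → 4 ≤ n → Connected G →
    ((HasDominating G → (m : ℕ) → 4 ≤ m →
        OutcomeSpoiler (K m ∘L G) × SpoilerWinsInTwoMoves (K m ∘L G))
    × (HasTwoDominating G → (m : ℕ) → (m ≡ 2 ⊎ m ≡ 3) →
        OutcomeSpoiler (K m ∘L G) × SpoilerWinsInTwoMoves (K m ∘L G)))
proposition4p3 n G _ _ = one-dominating , two-dominating
  where
  wins : ∀ m {q} → DominatingFamily G q → 4 ≤ m * q →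
         OutcomeSpoiler (K m ∘L G) × SpoilerWinsInTwoMoves (K m ∘L G)
  wins m D 4≤mq = SpoilerStrategy.spoiler-wins (K m ∘L G) (≡-dec Fin._≟_ Fin._≟_)
    (lex-dominatingFamily (K m) G Fin._≟_ (K-dominatingFamily m) D) 4≤mq

  one-dominating : HasDominating G → (m : ℕ) → 4 ≤ m →
                   OutcomeSpoiler (K m ∘L G) × SpoilerWinsInTwoMoves (K m ∘L G)
  one-dominating hasDom m 4≤m =
    wins m (dominatingFamily₁ hasDom) (subst (4 ≤_) (sym (*-identityʳ m)) 4≤m)

  two-dominating : HasTwoDominating G → (m : ℕ) → (m ≡ 2 ⊎ m ≡ 3) →
                   OutcomeSpoiler (K m ∘L G) × SpoilerWinsInTwoMoves (K m ∘L G)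
  two-dominating hasTwo .2 (inj₁ refl) = wins 2 (dominatingFamily₂ hasTwo) ≤-refl
  two-dominating hasTwo .3 (inj₂ refl) = wins 3 (dominatingFamily₂ hasTwo) (m≤m+n 4 2)
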